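{- Let $n \geq 1$ and let $L=\{\ell_1,\ldots,\ell_s\}$ be a set of $s$ non-negative integers. Let $\mathcal{F}=\{F_1,\ldots,F_m\}$ be a family of subsets of $[n]=\{1,\ldots,n\}$ such that $|F_i\cap F_j|\in L$ for all $1\leq i,j\leq m$ with $i\neq j$, and suppose $\mathcal{F}$ is ordered, i.e., there exists an index $1\leq r\leq m$ such that $n\in F_i$ for each $1\leq i\leq r$, $n\notin F_i$ for each $i>r$, and $|F_i|\leq |F_j|$ for each $1\leq i<j\leq m$. Then $$m\leq \sum_{i=0}^{s}\binom{n-1}{i}.$$
   Context: $[n]$ denotes the set $\{1,2,\ldots,n\}$. A family $\{F_1,\ldots,F_m\}$ of subsets of $[n]$ is called $L$-intersecting if $|F_i\cap F_j|\in L$ for all distinct indices $i\neq j$. -}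

module Defs where

open import Data.Nat using (ℕ; suc; _≤_; _<_)
open import Data.Fin using (Fin; toℕ; fromℕ)
open import Data.Product using (Σ; _×_)
open import Data.Fin.Subset using (Subset; _∩_; ∣_∣; _∈_; _∉_)
open import Data.List using (List; map; upTo)
open import Data.Nat.ListAction using (sum)
open import Data.List.Membership.Propositional using () renaming (_∈_ to _∈ₗ_)
open import Data.Nat.Combinatorics using (_C_)
open import Function.Definitions using (Injective)
open import Relation.Binary.PropositionalEquality using (_≡_)
open import Relation.Nullary using (¬_)

-- A family F_1..F_m of subsets of [n] (n = suc k, ground set Fin (suc k)),
-- indexed by Fin m. Being a *family* (set of sets), the members are distinct.
Family : ℕ → ℕ → Set
Family n m = Fin m → Subset n

Distinct : ∀ {n m} → Family n m → Set
Distinct F = Injective _≡_ _≡_ F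

LIntersecting : ∀ {n m} → List ℕ → Family n m → Set
LIntersecting L F = ∀ i j → ¬ (i ≡ j) → ∣ F i ∩ F j ∣ ∈ₗ L

-- Ordered: some 1 ≤ r ≤ m with the element n (= fromℕ k, the last element of
-- Fin (suc k)) in F_i exactly for the first r indices, and sizes nondecreasing.
Ordered : ∀ {k m} → Family (suc k) m → Set
Ordered {k} {m} F =
  Σ ℕ λ r → (1 ≤ r) × (r ≤ m)
    × (∀ i → toℕ i < r → fromℕ k ∈ F i)
    × (∀ i → r ≤ toℕ i → fromℕ k ∉ F i)
    × (∀ i j → toℕ i < toℕ j → ∣ F i ∣ ≤ ∣ F j ∣)

binomSum : ℕ → ℕ → ℕ
binomSum k s = sum (map (λ i → k C i) (upTo (suc s)))

{-# OPTIONS --safe #-}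
-- Write F_i = U_i ∪ E_i with U_i ⊆ [n−1] and E_i ⊆ {n}, and for x ⊆ [n−1] put
--   f_i(x) = ∏ { |E_i| + |U_i ∩ x| − ℓ : ℓ ∈ L, ℓ < |F_i| }.
-- Then f_i(U_i) ≠ 0, while for j < i the ordering gives |E_i| + |U_i ∩ U_j| = |F_i ∩ F_j| < |F_i|,
-- so f_i(U_j) = 0.  This triangularity makes f_1, …, f_m linearly independent.  Each f_i is a
-- multilinear polynomial of degree ≤ s on the cube {0,1}^(n−1), and such a polynomial is determined
-- by its values on the ∑_{i≤s} C(n−1,i) subsets of size ≤ s, so there are at most that many f_i.
module Submission where

open import Defs
open import Data.Nat as ℕ using (ℕ; zero; suc; _≤_; _<_; z≤n; s≤s)
open import Data.Nat.Properties
  using (m<n⇒m<1+n; ≮⇒≥; +-comm; +-suc; +-commutativeSemigroup; suc-injective; <⇒≢; ≤∧≢⇒<;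
         ≤-antisym; ≤-trans; ≤-reflexive; <-trans; ≰⇒>; _≤?_; _<?_)
open import Algebra.Properties.CommutativeSemigroup +-commutativeSemigroup using (interchange)
open import Data.Nat.Combinatorics using (_C_; nCk+nC[k+1]≡[n+1]C[k+1])
open import Data.Nat.ListAction using (sum)
open import Data.Integer using (ℤ; +_; _+_; _*_; _-_; -_; 0ℤ; 1ℤ)
import Data.Integer.Properties as ℤ
open import Data.Integer.Tactic.RingSolver using (solve-∀)
open import Algebra.Properties.Semiring.Sum ℤ.+-*-semiring
  using (sum-syntax; sum-remove; ∑-distrib-+; *-distribˡ-sum; sum-cong-≗; sum-replicate-zero)
open import Data.Bool using (Bool; true; false)
open import Data.Fin using (Fin; zero; suc; toℕ; fromℕ; punchIn)
open import Data.Fin.Properties using (all?; ¬∀⟶∃¬)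
open import Data.Fin.Subset using (Subset; inside; outside; _∩_; ∣_∣; _∈_)
open import Data.Fin.Subset.Properties using (∣p∩q∣≤∣p∣; ∩-comm; ∩-idem; drop-there)
open import Data.Vec using ([]; _∷_; here; there; init; last)
open import Data.Vec.Functional using (Vector; insertAt)
open import Data.Vec.Functional.Properties using (insertAt-lookup; insertAt-punchIn)
open import Data.List using (List; []; _∷_; length; map; _++_; applyUpTo; filter)
open import Data.List.Properties using (length-++; length-map; length-filter; map-upTo)
open import Data.List.Relation.Unary.Unique.Propositional using (Unique)
open import Data.List.Membership.Propositional using () renaming (_∈_ to _∈ₗ_)
open import Data.List.Membership.Propositional.Properties using (∈-filter⁺)
open import Data.List.Relation.Unary.Any using (here; there)
open import Data.List.Relation.Unary.All as All using (All; []; _∷_)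
open import Data.List.Relation.Unary.All.Properties using (++⁻; map⁻; all-filter)
open import Data.Product using (∃-syntax; _×_; _,_; proj₁; proj₂)
open import Data.Sum using (inj₁; inj₂)
open import Relation.Nullary using (yes; no; contradiction)
open import Function using (_∘_; id)
open import Relation.Binary.PropositionalEquality
open ≡-Reasoning

-- Linear relations over ℤ

combination : ∀ {X : Set} {m} → Vector ℤ m → (Fin m → X → ℤ) → X → ℤ
combination {m = m} c f x = ∑[ i < m ] (c i * f i x)

Nontrivial : ∀ {m} → Vector ℤ m → Set
Nontrivial c = ∃[ i ] c i ≢ 0ℤ

LinearlyIndependent : ∀ {X : Set} {m} → (Fin m → X → ℤ) → Set
LinearlyIndependent {m = m} f = ∀ (c : Vector ℤ m) → (∀ x → combination c f x ≡ 0ℤ) → ∀ i → c i ≡ 0ℤ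

*-≢0 : ∀ {i j} → i ≢ 0ℤ → j ≢ 0ℤ → i * j ≢ 0ℤ
*-≢0 {i} i≢0 j≢0 ij≡0 with ℤ.i*j≡0⇒i≡0∨j≡0 i ij≡0
... | inj₁ i≡0 = i≢0 i≡0
... | inj₂ j≡0 = j≢0 j≡0

module _ {X : Set} where

  combination-zero : ∀ {m} (c : Vector ℤ m) (f : Fin m → X → ℤ) {x} →
                     (∀ i → f i x ≡ 0ℤ) → combination c f x ≡ 0ℤ
  combination-zero {m} c f {x} f≡0 =
    trans (sum-cong-≗ λ i → trans (cong (c i *_) (f≡0 i)) (ℤ.*-zeroʳ (c i))) (sum-replicate-zero m)

  -- One step of Gaussian elimination, with pivot f i₀ p ≢ 0: the functions `eliminated` vanish at p,
  -- and every relation among them lifts to a relation among the f i.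
  module Elimination {m} (f : Fin (suc m) → X → ℤ) (p : X) (i₀ : Fin (suc m)) where

    pivot : ℤ
    pivot = f i₀ p

    others : Fin m → X → ℤ
    others j = f (punchIn i₀ j)

    eliminated : Fin m → X → ℤ
    eliminated j x = pivot * others j x - others j p * f i₀ x

    eliminated-vanishes : ∀ j → eliminated j p ≡ 0ℤ
    eliminated-vanishes j = trans (cong (_- others j p * pivot) (ℤ.*-comm pivot (others j p)))
                                  (ℤ.+-inverseʳ (others j p * pivot))

    lift : Vector ℤ m → Vector ℤ (suc m)
    lift μ = insertAt (λ j → pivot * μ j) i₀ (- combination μ others p)

    lift-nontrivial : pivot ≢ 0ℤ → ∀ {μ} → Nontrivial μ → Nontrivial (lift μ)
    lift-nontrivial pivot≢0 {μ} (j , μj≢0) =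
      punchIn i₀ j , λ e → *-≢0 pivot≢0 μj≢0 (trans (sym (insertAt-punchIn _ i₀ _ j)) e)

    combination-lift : ∀ μ x → combination (lift μ) f x ≡ combination μ eliminated x
    combination-lift μ x = begin
      combination (lift μ) f x
        ≡⟨ sum-remove {i = i₀} (λ i → lift μ i * f i x) ⟩
      lift μ i₀ * f i₀ x + ∑[ j < m ] (lift μ (punchIn i₀ j) * others j x)
        ≡⟨ cong₂ _+_ (cong (_* f i₀ x) (insertAt-lookup _ i₀ _))
                     (sum-cong-≗ λ j → cong (_* others j x) (insertAt-punchIn _ i₀ _ j)) ⟩
      - S * f i₀ x + A
        ≡⟨ regroup S (f i₀ x) A ⟩
      A + (- f i₀ x) * S
        ≡⟨ cong (_+_ A) (*-distribˡ-sum (- f i₀ x) (λ j → μ j * others j p)) ⟩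
      A + ∑[ j < m ] ((- f i₀ x) * (μ j * others j p))
        ≡⟨ ∑-distrib-+ (λ j → pivot * μ j * others j x) (λ j → (- f i₀ x) * (μ j * others j p)) ⟨
      ∑[ j < m ] (pivot * μ j * others j x + (- f i₀ x) * (μ j * others j p))
        ≡⟨ sum-cong-≗ (λ j → distribute (μ j) pivot (others j x) (others j p) (f i₀ x)) ⟩
      combination μ eliminated x ∎
      where
      S A : ℤ
      S = combination μ others p
      A = ∑[ j < m ] (pivot * μ j * others j x)
      regroup : ∀ s z a → - s * z + a ≡ a + (- z) * s
      regroup = solve-∀
      distribute : ∀ u a y q z → a * u * y + (- z) * (u * q) ≡ u * (a * y - q * z)
      distribute = solve-∀

  vanishing-combination : ∀ {m} (f : Fin m → X → ℤ) (ps : List X) → length ps < m →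
                          ∃[ c ] Nontrivial c × All (λ x → combination c f x ≡ 0ℤ) ps
  vanishing-combination f [] (s≤s _) = (λ _ → 1ℤ) , (zero , λ ()) , []
  vanishing-combination {suc m} f (p ∷ ps) (s≤s |ps|<m) with all? (λ i → f i p ℤ.≟ 0ℤ)
  ... | yes f≡0 =
    let c , nontrivial , vanishes = vanishing-combination f ps (m<n⇒m<1+n |ps|<m)
    in  c , nontrivial , combination-zero c f f≡0 ∷ vanishes
  ... | no f≢0 =
    let i₀ , pivot≢0 = ¬∀⟶∃¬ _ _ (λ i → f i p ℤ.≟ 0ℤ) f≢0
        open Elimination f p i₀
        μ , nontrivial , vanishes = vanishing-combination eliminated ps |ps|<m
    in  lift μ , lift-nontrivial pivot≢0 nontrivial
        , trans (combination-lift μ p) (combination-zero μ eliminated eliminated-vanishes)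
          ∷ All.map (λ {x} e → trans (combination-lift μ x) e) vanishes

  -- Evaluating at P zero kills every term but the leading one, so c zero ≡ 0; then recurse.
  triangular⇒independent : ∀ {m} (f : Fin m → X → ℤ) (P : Fin m → X) →
                           (∀ i → f i (P i) ≢ 0ℤ) →
                           (∀ {i j} → toℕ j < toℕ i → f i (P j) ≡ 0ℤ) →
                           LinearlyIndependent f
  triangular⇒independent {zero}  f P diagonal lower c vanishes ()
  triangular⇒independent {suc m} f P diagonal lower c vanishes = λ where
      zero    → c₀≡0
      (suc i) → triangular⇒independent (f ∘ suc) (P ∘ suc) (diagonal ∘ suc) (lower ∘ s≤s)
                                       (c ∘ suc) rest-vanishes i
    where
    rest : X → ℤ
    rest = combination (c ∘ suc) (f ∘ suc)

    rest≡0 : rest (P zero) ≡ 0ℤ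
    rest≡0 = combination-zero (c ∘ suc) (f ∘ suc) (λ _ → lower (s≤s z≤n))

    leading≡0 : c zero * f zero (P zero) ≡ 0ℤ
    leading≡0 = begin
      c zero * f zero (P zero)                ≡⟨ ℤ.+-identityʳ _ ⟨
      c zero * f zero (P zero) + 0ℤ           ≡⟨ cong (_+_ (c zero * f zero (P zero))) rest≡0 ⟨
      combination c f (P zero)                ≡⟨ vanishes (P zero) ⟩
      0ℤ                                      ∎

    c₀≡0 : c zero ≡ 0ℤ
    c₀≡0 with ℤ.i*j≡0⇒i≡0∨j≡0 (c zero) leading≡0
    ... | inj₁ c₀≡0 = c₀≡0
    ... | inj₂ f₀≡0 = contradiction f₀≡0 (diagonal zero)

    rest-vanishes : ∀ x → rest x ≡ 0ℤ
    rest-vanishes x = begin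
      rest x                                  ≡⟨ ℤ.+-identityˡ (rest x) ⟨
      0ℤ + rest x                             ≡⟨ cong (_+ rest x) (ℤ.*-zeroˡ (f zero x)) ⟨
      0ℤ * f zero x + rest x                  ≡⟨ cong (λ c₀ → c₀ * f zero x + rest x) c₀≡0 ⟨
      combination c f x                       ≡⟨ vanishes x ⟩
      0ℤ                                      ∎

-- Polynomials on the cube

Δ : ∀ {k} → (Subset (suc k) → ℤ) → Subset k → ℤ
Δ f x = f (inside ∷ x) - f (outside ∷ x)

data DegreeBelow : ∀ {k} → ℕ → (Subset k → ℤ) → Set where
  vanishing : ∀ {k} {f : Subset k → ℤ} → (∀ x → f x ≡ 0ℤ) → DegreeBelow zero f
  point     : ∀ {d} {f : Subset zero → ℤ} → DegreeBelow (suc d) f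
  split     : ∀ {k d} {f : Subset (suc k) → ℤ} →
              DegreeBelow (suc d) (f ∘ (outside ∷_)) → DegreeBelow d (Δ f) → DegreeBelow (suc d) f

DegreeBelow-cong : ∀ {k d} {f g : Subset k → ℤ} → (∀ x → f x ≡ g x) → DegreeBelow d f → DegreeBelow d g
DegreeBelow-cong f≗g (vanishing f≡0) = vanishing (λ x → trans (sym (f≗g x)) (f≡0 x))
DegreeBelow-cong f≗g point           = point
DegreeBelow-cong f≗g (split h₀ hΔ)   =
  split (DegreeBelow-cong (f≗g ∘ (outside ∷_)) h₀)
        (DegreeBelow-cong (λ x → cong₂ _-_ (f≗g (inside ∷ x)) (f≗g (outside ∷ x))) hΔ)

DegreeBelow-zero : ∀ {k} d → DegreeBelow {k} d (λ _ → 0ℤ)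
DegreeBelow-zero {k}     zero    = vanishing (λ _ → refl)
DegreeBelow-zero {zero}  (suc d) = point
DegreeBelow-zero {suc k} (suc d) = split (DegreeBelow-zero (suc d)) (DegreeBelow-zero d)

DegreeBelow-const : ∀ {k} d c → DegreeBelow {k} (suc d) (λ _ → c)
DegreeBelow-const {zero}  d c = point
DegreeBelow-const {suc k} d c =
  split (DegreeBelow-const d c) (DegreeBelow-cong (λ _ → sym (ℤ.+-inverseʳ c)) (DegreeBelow-zero d))

DegreeBelow-mono : ∀ {k d e} {f : Subset k → ℤ} → d ≤ e → DegreeBelow d f → DegreeBelow e f
DegreeBelow-mono {e = e} z≤n (vanishing f≡0) = DegreeBelow-cong (λ x → sym (f≡0 x)) (DegreeBelow-zero e)
DegreeBelow-mono (s≤s d≤e) point             = point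
DegreeBelow-mono (s≤s d≤e) (split h₀ hΔ)     =
  split (DegreeBelow-mono (s≤s d≤e) h₀) (DegreeBelow-mono d≤e hΔ)

DegreeBelow-+ : ∀ {k d} {f g : Subset k → ℤ} →
                DegreeBelow d f → DegreeBelow d g → DegreeBelow d (λ x → f x + g x)
DegreeBelow-+ (vanishing f≡0) (vanishing g≡0) = vanishing (λ x → cong₂ _+_ (f≡0 x) (g≡0 x))
DegreeBelow-+ point           point           = point
DegreeBelow-+ {f = f} {g} (split f₀ fΔ) (split g₀ gΔ) =
  split (DegreeBelow-+ f₀ g₀)
        (DegreeBelow-cong (λ x → regroup (f (inside ∷ x)) (f (outside ∷ x)) (g (inside ∷ x)) (g (outside ∷ x)))
                          (DegreeBelow-+ fΔ gΔ))
  where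
  regroup : ∀ a b c d → a - b + (c - d) ≡ a + c - (b + d)
  regroup = solve-∀

DegreeBelow-*ˡ : ∀ {k d} {f : Subset k → ℤ} c → DegreeBelow d f → DegreeBelow d (λ x → c * f x)
DegreeBelow-*ˡ c (vanishing f≡0) = vanishing (λ x → trans (cong (c *_) (f≡0 x)) (ℤ.*-zeroʳ c))
DegreeBelow-*ˡ c point           = point
DegreeBelow-*ˡ {f = f} c (split h₀ hΔ) =
  split (DegreeBelow-*ˡ c h₀)
        (DegreeBelow-cong (λ x → distribute c (f (inside ∷ x)) (f (outside ∷ x))) (DegreeBelow-*ˡ c hΔ))
  where
  distribute : ∀ c a b → c * (a - b) ≡ c * a - c * b
  distribute = solve-∀

affine : ∀ {k} → ℤ → Subset k → Subset k → ℤ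
affine c a x = c + + ∣ a ∩ x ∣

DegreeBelow-affine* : ∀ {k d} {f : Subset k → ℤ} c a →
                      DegreeBelow d f → DegreeBelow (suc d) (λ x → affine c a x * f x)
DegreeBelow-affine* c a (vanishing f≡0) =
  DegreeBelow-cong (λ x → sym (trans (cong (affine c a x *_) (f≡0 x)) (ℤ.*-zeroʳ (affine c a x))))
                   (DegreeBelow-zero 1)
DegreeBelow-affine* c []            point         = point
DegreeBelow-affine* {f = f} c (outside ∷ a) (split h₀ hΔ) =
  split (DegreeBelow-affine* c a h₀)
        (DegreeBelow-cong (λ x → distribute (affine c a x) (f (inside ∷ x)) (f (outside ∷ x)))
                          (DegreeBelow-affine* c a hΔ))
  where
  distribute : ∀ c a b → c * (a - b) ≡ c * a - c * b
  distribute = solve-∀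
-- Discrete product rule: Δ (affine c (inside ∷ a) · f) = affine (c + 1) a · Δ f + f ∘ (outside ∷_).
DegreeBelow-affine* {f = f} c (inside ∷ a) (split h₀ hΔ) =
  split (DegreeBelow-affine* c a h₀)
        (DegreeBelow-cong (λ x → trans (regroup c (+ ∣ a ∩ x ∣) (f (inside ∷ x)) (f (outside ∷ x)))
                                       (cong (λ n → (c + n) * f (inside ∷ x) - affine c a x * f (outside ∷ x))
                                             (sym (ℤ.pos-+ 1 ∣ a ∩ x ∣))))
                          (DegreeBelow-+ (DegreeBelow-affine* (c + 1ℤ) a hΔ) h₀))
  where
  regroup : ∀ c n a b → (c + 1ℤ + n) * (a - b) + b ≡ (c + (1ℤ + n)) * a - (c + n) * b
  regroup = solve-∀

DegreeBelow-combination : ∀ {k d m} (c : Vector ℤ m) {f : Fin m → Subset k → ℤ} →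
                          (∀ i → DegreeBelow d (f i)) → DegreeBelow d (combination c f)
DegreeBelow-combination {d = d} {zero} c deg = DegreeBelow-zero d
DegreeBelow-combination {m = suc m} c deg =
  DegreeBelow-+ (DegreeBelow-*ˡ (c zero) (deg zero)) (DegreeBelow-combination (c ∘ suc) (deg ∘ suc))

subsetsOfSize< : ∀ k → ℕ → List (Subset k)
subsetsOfSize< k       zero    = []
subsetsOfSize< zero    (suc d) = [] ∷ []
subsetsOfSize< (suc k) (suc d) =
  map (outside ∷_) (subsetsOfSize< k (suc d)) ++ map (inside ∷_) (subsetsOfSize< k d)

vanishing-on-subsetsOfSize<⇒≡0 : ∀ {k d} {f : Subset k → ℤ} → DegreeBelow d f →
                                 All (λ x → f x ≡ 0ℤ) (subsetsOfSize< k d) → ∀ x → f x ≡ 0ℤ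
vanishing-on-subsetsOfSize<⇒≡0 (vanishing f≡0) _               = f≡0
vanishing-on-subsetsOfSize<⇒≡0 point           (f[]≡0 ∷ []) [] = f[]≡0
vanishing-on-subsetsOfSize<⇒≡0 {suc k} {suc d} {f} (split h₀ hΔ) zeros = λ where
    (outside ∷ x) → f₀≡0 x
    (inside ∷ x)  → trans (restore (f (inside ∷ x)) (f (outside ∷ x))) (cong₂ _+_ (Δf≡0 x) (f₀≡0 x))
  where
  restore : ∀ a b → a ≡ a - b + b
  restore = solve-∀
  zeros₀ : All (λ x → f (outside ∷ x) ≡ 0ℤ) (subsetsOfSize< k (suc d))
  zeros₀ = map⁻ (proj₁ (++⁻ (map (outside ∷_) (subsetsOfSize< k (suc d))) zeros))
  zeros₁ : All (λ x → f (inside ∷ x) ≡ 0ℤ) (subsetsOfSize< k d)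
  zeros₁ = map⁻ (proj₂ (++⁻ (map (outside ∷_) (subsetsOfSize< k (suc d))) zeros))
  f₀≡0 : ∀ x → f (outside ∷ x) ≡ 0ℤ
  f₀≡0 = vanishing-on-subsetsOfSize<⇒≡0 h₀ zeros₀
  Δf≡0 : ∀ x → Δ f x ≡ 0ℤ
  Δf≡0 = vanishing-on-subsetsOfSize<⇒≡0 hΔ (All.map (λ {x} f₁≡0 → cong₂ _-_ f₁≡0 (f₀≡0 x)) zeros₁)

sum-applyUpTo-+ : ∀ {f g h : ℕ → ℕ} → (∀ i → h i ≡ f i ℕ.+ g i) → ∀ d →
                  sum (applyUpTo h d) ≡ sum (applyUpTo f d) ℕ.+ sum (applyUpTo g d)
sum-applyUpTo-+         h≗f+g zero    = refl
sum-applyUpTo-+ {f} {g} h≗f+g (suc d) =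
  trans (cong₂ ℕ._+_ (h≗f+g 0) (sum-applyUpTo-+ (h≗f+g ∘ suc) d))
        (interchange (f 0) (g 0) (sum (applyUpTo (f ∘ suc) d)) (sum (applyUpTo (g ∘ suc) d)))

sum-applyUpTo-zero : ∀ d → sum (applyUpTo (λ _ → 0) d) ≡ 0
sum-applyUpTo-zero zero    = refl
sum-applyUpTo-zero (suc d) = sum-applyUpTo-zero d

length-subsetsOfSize< : ∀ k d → length (subsetsOfSize< k d) ≡ sum (applyUpTo (k C_) d)
length-subsetsOfSize< k       zero    = refl
length-subsetsOfSize< zero    (suc d) = cong suc (sym (sum-applyUpTo-zero d))
length-subsetsOfSize< (suc k) (suc d) = begin
  length (map (outside ∷_) small ++ map (inside ∷_) smaller)
    ≡⟨ length-++ (map (outside ∷_) small) ⟩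
  length (map (outside ∷_) small) ℕ.+ length (map (inside ∷_) smaller)
    ≡⟨ cong₂ ℕ._+_ (length-map (outside ∷_) small) (length-map (inside ∷_) smaller) ⟩
  length small ℕ.+ length smaller
    ≡⟨ cong₂ ℕ._+_ (length-subsetsOfSize< k (suc d)) (length-subsetsOfSize< k d) ⟩
  suc (sum (applyUpTo ((k C_) ∘ suc) d) ℕ.+ sum (applyUpTo (k C_) d))
    ≡⟨ cong suc (+-comm (sum (applyUpTo ((k C_) ∘ suc) d)) _) ⟩
  suc (sum (applyUpTo (k C_) d) ℕ.+ sum (applyUpTo ((k C_) ∘ suc) d))
    ≡⟨ cong suc (sum-applyUpTo-+ (λ i → sym (nCk+nC[k+1]≡[n+1]C[k+1] k i)) d) ⟨
  sum (applyUpTo (suc k C_) (suc d)) ∎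
  where
  small smaller : List (Subset k)
  small   = subsetsOfSize< k (suc d)
  smaller = subsetsOfSize< k d

independent⇒≤#subsetsOfSize< : ∀ {k d m} {f : Fin m → Subset k → ℤ} → (∀ i → DegreeBelow d (f i)) →
                               LinearlyIndependent f → m ≤ length (subsetsOfSize< k d)
independent⇒≤#subsetsOfSize< {k} {d} {f = f} deg independent = ≮⇒≥ λ fewer →
  let c , (i , cᵢ≢0) , vanishes = vanishing-combination f (subsetsOfSize< k d) fewer
  in  cᵢ≢0 (independent c (vanishing-on-subsetsOfSize<⇒≡0 (DegreeBelow-combination c deg) vanishes) i)

annihilator : ∀ {k} → ℤ → Subset k → List ℕ → Subset k → ℤ
annihilator c a []      x = 1ℤ
annihilator c a (ℓ ∷ L) x = affine (c - + ℓ) a x * annihilator c a L x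

affine-shift : ∀ {k} c ℓ (a x : Subset k) → affine (c - ℓ) a x ≡ affine c a x - ℓ
affine-shift c ℓ a x = shift c ℓ (+ ∣ a ∩ x ∣)
  where
  shift : ∀ c ℓ n → c - ℓ + n ≡ c + n - ℓ
  shift = solve-∀

DegreeBelow-annihilator : ∀ {k} c (a : Subset k) L → DegreeBelow (suc (length L)) (annihilator c a L)
DegreeBelow-annihilator c a []      = DegreeBelow-const 0 1ℤ
DegreeBelow-annihilator c a (ℓ ∷ L) = DegreeBelow-affine* (c - + ℓ) a (DegreeBelow-annihilator c a L)

annihilator-root : ∀ {k} c (a x : Subset k) {ℓ L} → ℓ ∈ₗ L → affine c a x ≡ + ℓ →
                   annihilator c a L x ≡ 0ℤ
annihilator-root c a x {ℓ} {_ ∷ L} (here refl) value≡ℓ =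
  trans (cong (_* annihilator c a L x) (trans (affine-shift c (+ ℓ) a x) (ℤ.i≡j⇒i-j≡0 value≡ℓ)))
        (ℤ.*-zeroˡ (annihilator c a L x))
annihilator-root c a x {L = ℓ′ ∷ _} (there ℓ∈L) value≡ℓ =
  trans (cong (affine (c - + ℓ′) a x *_) (annihilator-root c a x ℓ∈L value≡ℓ))
        (ℤ.*-zeroʳ (affine (c - + ℓ′) a x))

annihilator-nonzero : ∀ {k} c (a x : Subset k) {L} → All (λ ℓ → affine c a x ≢ + ℓ) L →
                      annihilator c a L x ≢ 0ℤ
annihilator-nonzero c a x []                  = λ ()
annihilator-nonzero c a x {ℓ ∷ _} (value≢ℓ ∷ rest) =
  *-≢0 (λ factor≡0 → value≢ℓ (ℤ.i-j≡0⇒i≡j _ _ (trans (sym (affine-shift c (+ ℓ) a x)) factor≡0)))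
       (annihilator-nonzero c a x rest)

-- The polynomials of an ordered family

∣p∩q∣≡∣p∣⇒p∩q≡p : ∀ {n} (p q : Subset n) → ∣ p ∩ q ∣ ≡ ∣ p ∣ → p ∩ q ≡ p
∣p∩q∣≡∣p∣⇒p∩q≡p []            []            _ = refl
∣p∩q∣≡∣p∣⇒p∩q≡p (inside ∷ p)  (inside ∷ q)  e = cong (inside ∷_) (∣p∩q∣≡∣p∣⇒p∩q≡p p q (suc-injective e))
∣p∩q∣≡∣p∣⇒p∩q≡p (inside ∷ p)  (outside ∷ q) e = contradiction e (<⇒≢ (s≤s (∣p∩q∣≤∣p∣ p q)))
∣p∩q∣≡∣p∣⇒p∩q≡p (outside ∷ p) (_ ∷ q)       e = cong (outside ∷_) (∣p∩q∣≡∣p∣⇒p∩q≡p p q e)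

∣p∩q∣<∣p∣ : ∀ {n} {p q : Subset n} → p ≢ q → ∣ q ∣ ≤ ∣ p ∣ → ∣ p ∩ q ∣ < ∣ p ∣
∣p∩q∣<∣p∣ {p = p} {q} p≢q ∣q∣≤∣p∣ = ≤∧≢⇒< (∣p∩q∣≤∣p∣ p q) (p≢q ∘ same)
  where
  same : ∣ p ∩ q ∣ ≡ ∣ p ∣ → p ≡ q
  same ∣p∩q∣≡∣p∣ = begin
    p      ≡⟨ ∣p∩q∣≡∣p∣⇒p∩q≡p p q ∣p∩q∣≡∣p∣ ⟨
    p ∩ q  ≡⟨ ∩-comm p q ⟩
    q ∩ p  ≡⟨ ∣p∩q∣≡∣p∣⇒p∩q≡p q p (≤-antisym (∣p∩q∣≤∣p∣ q p) ∣q∣≤∣q∩p∣) ⟩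
    q      ∎
    where
    ∣q∣≤∣q∩p∣ : ∣ q ∣ ≤ ∣ q ∩ p ∣
    ∣q∣≤∣q∩p∣ = ≤-trans ∣q∣≤∣p∣ (≤-reflexive (trans (sym ∣p∩q∣≡∣p∣) (cong ∣_∣ (∩-comm p q))))

indicator : Bool → ℕ
indicator true  = 1
indicator false = 0

∣p∩q∣≡last+∣init∩init∣ : ∀ {k} (p q : Subset (suc k)) → (fromℕ k ∈ p → fromℕ k ∈ q) →
                         ∣ p ∩ q ∣ ≡ indicator (last p) ℕ.+ ∣ init p ∩ init q ∣
∣p∩q∣≡last+∣init∩init∣ {zero}  (inside ∷ [])  (inside ∷ [])  _ = refl
∣p∩q∣≡last+∣init∩init∣ {zero}  (inside ∷ [])  (outside ∷ []) last∈p⇒last∈q with last∈p⇒last∈q here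
... | ()
∣p∩q∣≡last+∣init∩init∣ {zero}  (outside ∷ []) (_ ∷ [])       _ = refl
∣p∩q∣≡last+∣init∩init∣ {suc k} (inside ∷ p)   (inside ∷ q)   last∈p⇒last∈q =
  trans (cong suc (∣p∩q∣≡last+∣init∩init∣ p q (drop-there ∘ last∈p⇒last∈q ∘ there))) (sym (+-suc _ _))
∣p∩q∣≡last+∣init∩init∣ {suc k} (inside ∷ p)   (outside ∷ q)  last∈p⇒last∈q =
  ∣p∩q∣≡last+∣init∩init∣ p q (drop-there ∘ last∈p⇒last∈q ∘ there)
∣p∩q∣≡last+∣init∩init∣ {suc k} (outside ∷ p)  (_ ∷ q)        last∈p⇒last∈q =
  ∣p∩q∣≡last+∣init∩init∣ p q (drop-there ∘ last∈p⇒last∈q ∘ there)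

affine-init≡∣p∩q∣ : ∀ {k} (p q : Subset (suc k)) → (fromℕ k ∈ p → fromℕ k ∈ q) →
                    affine (+ indicator (last p)) (init p) (init q) ≡ + ∣ p ∩ q ∣
affine-init≡∣p∩q∣ p q last∈p⇒last∈q =
  trans (sym (ℤ.pos-+ (indicator (last p)) _)) (cong +_ (sym (∣p∩q∣≡last+∣init∩init∣ p q last∈p⇒last∈q)))

ordered⇒last∈-downward : ∀ {k m} {F : Family (suc k) m} → Ordered F →
                         ∀ {i j} → toℕ j < toℕ i → fromℕ k ∈ F i → fromℕ k ∈ F j
ordered⇒last∈-downward (r , _ , _ , before-r , from-r , _) {i} {j} j<i last∈Fᵢ with r ≤? toℕ i
... | yes r≤i = contradiction last∈Fᵢ (from-r i r≤i)
... | no  r≰i = before-r j (<-trans j<i (≰⇒> r≰i))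

module Polynomials {k m} (L : List ℕ) (F : Family (suc k) m) where

  ε : Fin m → ℤ
  ε i = + indicator (last (F i))

  roots : Fin m → List ℕ
  roots i = filter (_<? ∣ F i ∣) L

  polynomial : Fin m → Subset k → ℤ
  polynomial i = annihilator (ε i) (init (F i)) (roots i)

  polynomial-degree : ∀ i → DegreeBelow (suc (length L)) (polynomial i)
  polynomial-degree i = DegreeBelow-mono (s≤s (length-filter (_<? ∣ F i ∣) L))
                                         (DegreeBelow-annihilator (ε i) (init (F i)) (roots i))

  polynomial-diagonal : ∀ i → polynomial i (init (F i)) ≢ 0ℤ
  polynomial-diagonal i = annihilator-nonzero _ _ _ (All.map root≢value (all-filter (_<? ∣ F i ∣) L))
    where
    value≡∣Fᵢ∣ : affine (ε i) (init (F i)) (init (F i)) ≡ + ∣ F i ∣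
    value≡∣Fᵢ∣ = trans (affine-init≡∣p∩q∣ (F i) (F i) id) (cong (+_ ∘ ∣_∣) (∩-idem (F i)))
    root≢value : ∀ {ℓ} → ℓ < ∣ F i ∣ → affine (ε i) (init (F i)) (init (F i)) ≢ + ℓ
    root≢value ℓ<∣Fᵢ∣ value≡ℓ = <⇒≢ ℓ<∣Fᵢ∣ (ℤ.+-injective (trans (sym value≡ℓ) value≡∣Fᵢ∣))

  polynomial-lower : Distinct F → LIntersecting L F → Ordered F →
                     ∀ {i j} → toℕ j < toℕ i → polynomial i (init (F j)) ≡ 0ℤ
  polynomial-lower distinct intersecting ordered@(_ , _ , _ , _ , _ , sizes) {i} {j} j<i =
    annihilator-root _ _ _
      (∈-filter⁺ (_<? ∣ F i ∣) (intersecting i j i≢j) (∣p∩q∣<∣p∣ (i≢j ∘ distinct) (sizes j i j<i)))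
      (affine-init≡∣p∩q∣ (F i) (F j) (ordered⇒last∈-downward ordered j<i))
    where
    i≢j : i ≢ j
    i≢j i≡j = <⇒≢ j<i (cong toℕ (sym i≡j))

length-subsetsOfSize≤ : ∀ k s → length (subsetsOfSize< k (suc s)) ≡ binomSum k s
length-subsetsOfSize≤ k s =
  trans (length-subsetsOfSize< k (suc s)) (cong sum (sym (map-upTo (k C_) (suc s))))

theorem3 : (k m : ℕ) (L : List ℕ) → Unique L → (F : Family (suc k) m) →
    Distinct F → LIntersecting L F → Ordered F → m ≤ binomSum k (length L)
theorem3 k m L _ F distinct intersecting ordered =
  subst (m ≤_) (length-subsetsOfSize≤ k (length L))
        (independent⇒≤#subsetsOfSize< polynomial-degree independent)
  where
  open Polynomials L F
  independent : LinearlyIndependent polynomial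
  independent = triangular⇒independent polynomial (init ∘ F) polynomial-diagonal
                                       (polynomial-lower distinct intersecting ordered)
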